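{- Let $\mathbf{h}$ be a weakly increasing sequence of positive integers with $\mathbf{h}(i)>i$ for all $i$, let $S\subseteq\mathcal{P}_\mathbf{h}$ be a nonempty $\mathbf{h}$-admissible set and $m=\mathbf{m}(S)$. Then the polynomial $\mathcal{I}_\mathbf{h}(S;n)$ is constant if and only if there is no $i\le m$ such that both (1) $(i,j)\in S$ for all $j$ with $i<j\le\mathbf{h}(i)$, and (2) $(k,i)\notin S$ for all $k$ with $k<i\le\mathbf{h}(k)$. Equivalently, $\mathcal{I}_\mathbf{h}(S;n)$ is constant if and only if $\mathbf{h}(m)$ is the unique maximal element of the poset $P_{\mathbf{h},S}$.
   Context: $\mathcal{P}_\mathbf{h}=\{(i,j): i<j\le \mathbf{h}(i)\}$. For $\pi\in S_n$, $\mathrm{inv}_\mathbf{h}(\pi)=\{(i,j)\in\mathcal{P}_\mathbf{h}: j\le n,\ \pi_i>\pi_j\}$. $S$ is $\mathbf{h}$-admissible if $S=\mathrm{inv}_\mathbf{h}(\pi)$ for some permutation $\pi$. $\mathcal{I}_\mathbf{h}(S;n)=\#\{\pi\in S_n:\mathrm{inv}_\mathbf{h}(\pi)=S\}$; this agrees with a polynomial in $n$ for all $n\ge\mathbf{j}(S)=\max\{j:(i,j)\in S\}$, and "$\mathcal{I}_\mathbf{h}(S;n)$" also denotes that polynomial. $\mathbf{m}(S)=\max\{i:(i,i+1)\in S\}$. $P_{\mathbf{h},S}$ is the poset on $[\mathbf{h}(m)]$ whose order $<_S$ is generated by $i>_S j$ whenever $(i,j)\in S$, and $i<_S j$ whenever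 $(i,j)\in\mathcal{P}_\mathbf{h}\setminus S$ with $j\le\mathbf{h}(m)$. -}

module Defs where

open import Data.Nat using (ℕ; zero; suc; _≤_; _<_; _⊔_; _≤?_; _<?_)
import Data.Nat.Properties as ℕₚ
open import Data.Product using (Σ; _×_; _,_; proj₁; proj₂)
open import Data.Product.Properties using (≡-dec)
open import Data.List using (List; []; _∷_; map; concatMap; filter; length; foldr; upTo)
open import Data.List.Relation.Unary.All using (All; all?)
open import Data.List.Relation.Unary.Unique.Propositional using (Unique)
open import Data.List.Relation.Unary.Unique.DecPropositional ℕₚ._≟_ using (unique?)
open import Data.List.Membership.DecPropositional (≡-dec ℕₚ._≟_ ℕₚ._≟_) using (_∈_; _∉_; _∈?_)
open import Relation.Binary.Construct.Closure.Transitive using (TransClosure)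
open import Relation.Binary.PropositionalEquality using (_≡_)
open import Relation.Nullary using (¬_; Dec; does)
open import Relation.Nullary.Decidable using (_×-dec_)
open import Data.Sum using (_⊎_)
open import Data.Bool using (if_then_else_)

-- Positions and values are 1-based natural numbers.
-- A set of pairs S is represented by a finite list of pairs (read as a set).
Pair : Set
Pair = ℕ × ℕ

InPh : (ℕ → ℕ) → Pair → Set
InPh h (i , j) = 1 ≤ i × i < j × j ≤ h i

oneTo : ℕ → List ℕ
oneTo n = map suc (upTo n)

words : ℕ → ℕ → List (List ℕ)
words zero    n = [] ∷ []
words (suc k) n = concatMap (λ w → map (λ x → x ∷ w) (oneTo n)) (words k n)

-- S_n in one-line notation: words of length n over {1,…,n} with distinct letters
perms : ℕ → List (List ℕ)
perms n = filter unique? (words n n)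

-- π_i for a permutation in one-line notation (1-based; 0 outside range)
at : List ℕ → ℕ → ℕ
at []       _             = 0
at (x ∷ xs) zero          = 0
at (x ∷ xs) (suc zero)    = x
at (x ∷ xs) (suc (suc i)) = at xs (suc i)

pairsUpTo : ℕ → List Pair
pairsUpTo n = concatMap (λ i → map (λ j → (i , j)) (oneTo n)) (oneTo n)

InInv : (ℕ → ℕ) → ℕ → List ℕ → Pair → Set
InInv h n π (i , j) = InPh h (i , j) × j ≤ n × at π j < at π i

InInv? : (h : ℕ → ℕ) (n : ℕ) (π : List ℕ) (p : Pair) → Dec (InInv h n π p)
InInv? h n π (i , j) =
  ((1 ≤? i) ×-dec ((i <? j) ×-dec (j ≤? h i))) ×-dec ((j ≤? n) ×-dec (at π j <? at π i))

inv : (ℕ → ℕ) → ℕ → List ℕ → List Pair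
inv h n π = filter (InInv? h n π) (pairsUpTo n)

SameSet : List Pair → List Pair → Set
SameSet A B = All (_∈ B) A × All (_∈ A) B

SameSet? : (A B : List Pair) → Dec (SameSet A B)
SameSet? A B = all? (_∈? B) A ×-dec all? (_∈? A) B

I : (ℕ → ℕ) → List Pair → ℕ → ℕ
I h S n = length (filter (λ π → SameSet? (inv h n π) S) (perms n))

Admissible : (ℕ → ℕ) → List Pair → Set
Admissible h S = Σ ℕ λ n → Σ (List ℕ) λ π → π ∈ₗ perms n × SameSet (inv h n π) S
  where open import Data.List.Membership.Propositional renaming (_∈_ to _∈ₗ_)

jS : List Pair → ℕ
jS = foldr (λ p acc → proj₂ p ⊔ acc) 0

mS : List Pair → ℕ
mS = foldr (λ p acc → if does (proj₂ p ℕₚ.≟ suc (proj₁ p)) then proj₁ p ⊔ acc else acc) 0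

-- The polynomial I_h(S; n) (which agrees with I h S n for all n ≥ j(S)) is constant
ConstantI : (ℕ → ℕ) → List Pair → Set
ConstantI h S = Σ ℕ λ c → ∀ n → jS S ≤ n → I h S n ≡ c

BadIndex : (ℕ → ℕ) → List Pair → ℕ → Set
BadIndex h S i =
  1 ≤ i × i ≤ mS S
  × (∀ j → i < j → j ≤ h i → (i , j) ∈ S)
  × (∀ k → 1 ≤ k → k < i → i ≤ h k → (k , i) ∉ S)

GenS : (ℕ → ℕ) → List Pair → ℕ → ℕ → Set
GenS h S x y = ((y , x) ∈ S) ⊎ (InPh h (x , y) × (x , y) ∉ S × y ≤ h (mS S))

LtS : (ℕ → ℕ) → List Pair → ℕ → ℕ → Set
LtS h S = TransClosure (GenS h S)

MaximalS : (ℕ → ℕ) → List Pair → ℕ → Set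
MaximalS h S x = 1 ≤ x × x ≤ h (mS S) × (∀ y → ¬ LtS h S x y)

UniqueMaxS : (ℕ → ℕ) → List Pair → Set
UniqueMaxS h S = MaximalS h S (h (mS S)) × (∀ x → MaximalS h S x → x ≡ h (mS S))

{-# OPTIONS --safe #-}
-- Appending the value n + 1 to a permutation of size n keeps its h-inversion set, so I_h(S; n) is
-- weakly increasing, and from n = j(S) on it is constant iff every permutation of size n + 1 with
-- inversion set S ends with n + 1. If the largest value at positions 1, …, K of such a permutation
-- sits at a position x < K, where K > j(S) or K ≥ h(m), then every (x, j) ∈ P_h is an inversion
-- and no (k, x) is: x is a bad index. Conversely, given a bad index i and a permutation p of size
-- N > h(m) with inversion set S, raising p(i) to the new value N + 1 (closing the gap it leaves)
-- and appending N gives a permutation with inversion set S that does not end with N + 1, so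
-- I_h(S; N) < I_h(S; N + 1). In P_{h,S}, a bad index i is maximal and i < h(i) ≤ h(m), and a
-- maximal element other than h(m) is a bad index; without bad indices, the prefix argument at
-- K = h(m) shows that h(m) is maximal.
module Submission where

open import Defs
open import Data.Nat using (ℕ; _≤_; _<_)
open import Data.Product using (Σ; _×_)
open import Data.List using (List; [])
open import Data.List.Relation.Unary.All using (All)
open import Relation.Binary.PropositionalEquality using (_≢_)
open import Relation.Nullary using (¬_)
open import Function.Bundles using (_⇔_)

open import Data.Bool using (true; false)
open import Data.Empty using (⊥-elim)
open import Data.Nat using (zero; suc; pred; _+_; _∸_; _≡ᵇ_; z≤n; s≤s; >-nonZero)
open import Data.Nat.Properties
open import Data.Product using (_,_; _,′_; proj₁; proj₂; map₂)
open import Data.Product.Properties using (≡-dec)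
open import Data.Sum using (_⊎_; inj₁; inj₂)
open import Data.List
  using (_∷_; _++_; [_]; _∷ʳ_; map; length; upTo; concatMap; cartesianProductWith; filter; initLast; _∷ʳ′_)
open import Data.List.Properties
  using (length-++; length-++-sucʳ; length-map; length-upTo; ∷ʳ-injectiveˡ; ∷ʳ-injectiveʳ)
open import Data.List.Extrema.Nat using (argmax; argmax-all; f[xs]≤f[argmax])
import Data.List.Relation.Unary.All as All
open import Data.List.Relation.Unary.All using ([]; _∷_)
import Data.List.Relation.Unary.All.Properties as AllP
open import Data.List.Relation.Unary.Any using (here; there)
open import Data.List.Relation.Unary.AllPairs using ([]; _∷_)
open import Data.List.Relation.Unary.Unique.Propositional using (Unique)
import Data.List.Relation.Unary.Unique.Propositional.Properties as Unique
open import Data.List.Relation.Unary.Unique.DecPropositional _≟_ using (unique?)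
open import Data.List.Relation.Binary.Subset.Propositional using (_⊆_)
open import Data.List.Membership.Propositional using (_∈_; _∉_)
open import Data.List.Membership.Propositional.Properties
open import Data.List.Membership.DecPropositional (≡-dec _≟_ _≟_) using (_∈?_)
open import Function using (_∘_; case_of_; mk⇔)
open import Function.Properties.Equivalence using () renaming (trans to ⇔-trans)
open import Relation.Binary.Definitions using (tri<; tri≈; tri>)
open import Relation.Binary.Construct.Closure.Transitive using (TransClosure)
open TransClosure using (_∷_) renaming ([_] to [_]⁺)
open import Relation.Binary.PropositionalEquality hiding ([_]; J)
open import Relation.Nullary using (contradiction; does; yes; no)

≢[]⇒∈ : {A : Set} {xs : List A} → xs ≢ [] → Σ A (_∈ xs)
≢[]⇒∈ {xs = []}    xs≢[] = contradiction refl xs≢[]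
≢[]⇒∈ {xs = x ∷ _} _     = x , here refl

length-∷ʳ : {A : Set} (xs : List A) (x : A) → length (xs ∷ʳ x) ≡ suc (length xs)
length-∷ʳ xs x = trans (length-++ xs) (+-comm (length xs) 1)

concatMap-map : {A B C : Set} (f : A → B → C) (xs : List A) (ys : List B) →
                concatMap (λ x → map (f x) ys) xs ≡ cartesianProductWith f xs ys
concatMap-map f []       ys = refl
concatMap-map f (x ∷ xs) ys = cong (map (f x) ys ++_) (concatMap-map f xs ys)

unique⊆⇒length≤ : {A : Set} {xs ys : List A} → Unique xs → xs ⊆ ys → length xs ≤ length ys
unique⊆⇒length≤ {xs = []}     _                       _     = z≤n
unique⊆⇒length≤ {xs = x ∷ xs} (x∉xs ∷ xs-unique) xs⊆ys with ∈-∃++ (xs⊆ys (here refl))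
... | us , vs , refl =
  subst (suc (length xs) ≤_) (sym (length-++-sucʳ us x vs)) (s≤s (unique⊆⇒length≤ xs-unique xs⊆us++vs))
  where
  xs⊆us++vs : xs ⊆ us ++ vs
  xs⊆us++vs {z} z∈xs with ∈-++⁻ us (xs⊆ys (there z∈xs))
  ... | inj₁ z∈us         = ∈-++⁺ˡ z∈us
  ... | inj₂ (here z≡x)   = contradiction (sym z≡x) (All.lookup x∉xs z∈xs)
  ... | inj₂ (there z∈vs) = ∈-++⁺ʳ us z∈vs

map-unique-on : {A B : Set} {P : A → Set} {f : A → B} {xs : List A} →
                (∀ {x y} → P x → P y → f x ≡ f y → x ≡ y) →
                All P xs → Unique xs → Unique (map f xs)
map-unique-on f-inj []          []                 = []
map-unique-on f-inj (px ∷ pxs) (x∉xs ∷ xs-unique) =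
  AllP.map⁺ (All.zipWith (λ (py , x≢y) fx≡fy → x≢y (f-inj px py fx≡fy)) (pxs , x∉xs))
  ∷ map-unique-on f-inj pxs xs-unique

unique-∷ʳ⁻ : {A : Set} (xs : List A) {v : A} → Unique (xs ∷ʳ v) → Unique xs × v ∉ xs
unique-∷ʳ⁻ []       _                        = [] , λ ()
unique-∷ʳ⁻ (x ∷ xs) (x∉xs∷ʳv ∷ xs∷ʳv-unique) with unique-∷ʳ⁻ xs xs∷ʳv-unique
... | xs-unique , v∉xs =
  AllP.++⁻ˡ xs x∉xs∷ʳv ∷ xs-unique ,
  λ { (here refl) → All.head (AllP.++⁻ʳ xs x∉xs∷ʳv) refl ; (there v∈xs) → v∉xs v∈xs }

InRange : ℕ → ℕ → Set
InRange n y = 1 ≤ y × y ≤ n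

inRange-pair : ∀ {n a b} → 1 ≤ a → a < b → b ≤ n → InRange n a × InRange n b
inRange-pair 1≤a a<b b≤n = (1≤a , ≤-trans (<⇒≤ a<b) b≤n) , (≤-trans 1≤a (<⇒≤ a<b) , b≤n)

at-∈ : ∀ π {k} → InRange (length π) k → at π k ∈ π
at-∈ (x ∷ π) {suc zero}    _             = here refl
at-∈ (x ∷ π) {suc (suc k)} (_ , s≤s k≤) = there (at-∈ π (s≤s z≤n , k≤))

∈⇒at : ∀ π {y} → y ∈ π → Σ ℕ λ k → InRange (length π) k × at π k ≡ y
∈⇒at (x ∷ π) (here refl) = 1 , (s≤s z≤n , s≤s z≤n) , refl
∈⇒at (x ∷ π) (there y∈π) with ∈⇒at π y∈π
... | suc k , (_ , k≤) , πk≡y = suc (suc k) , (s≤s z≤n , s≤s k≤) , πk≡y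

at-injective : ∀ π → Unique π → ∀ {a b} → InRange (length π) a → InRange (length π) b →
               at π a ≡ at π b → a ≡ b
at-injective (x ∷ π) _ {suc zero} {suc zero} _ _ _ = refl
at-injective (x ∷ π) (x∉π ∷ _) {suc zero} {suc (suc b)} _ (_ , s≤s b≤) x≡πb =
  contradiction x≡πb (All.lookup x∉π (at-∈ π (s≤s z≤n , b≤)))
at-injective (x ∷ π) (x∉π ∷ _) {suc (suc a)} {suc zero} (_ , s≤s a≤) _ πa≡x =
  contradiction (sym πa≡x) (All.lookup x∉π (at-∈ π (s≤s z≤n , a≤)))
at-injective (x ∷ π) (_ ∷ π-unique) {suc (suc a)} {suc (suc b)} (_ , s≤s a≤) (_ , s≤s b≤) πa≡πb =
  cong suc (at-injective π π-unique (s≤s z≤n , a≤) (s≤s z≤n , b≤) πa≡πb)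

at-++ˡ : ∀ ρ ys {k} → InRange (length ρ) k → at (ρ ++ ys) k ≡ at ρ k
at-++ˡ (x ∷ ρ) ys {suc zero}    _             = refl
at-++ˡ (x ∷ ρ) ys {suc (suc k)} (_ , s≤s k≤) = at-++ˡ ρ ys (s≤s z≤n , k≤)

at-∷ʳ : ∀ ρ v {n} → length ρ ≡ n → at (ρ ∷ʳ v) (suc n) ≡ v
at-∷ʳ []          v refl = refl
at-∷ʳ (x ∷ [])    v refl = refl
at-∷ʳ (x ∷ y ∷ ρ) v refl = at-∷ʳ (y ∷ ρ) v refl

at-map : ∀ (f : ℕ → ℕ) π {k} → InRange (length π) k → at (map f π) k ≡ f (at π k)
at-map f (x ∷ π) {suc zero}    _             = refl
at-map f (x ∷ π) {suc (suc k)} (_ , s≤s k≤) = at-map f π (s≤s z≤n , k≤)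

descent : ∀ π {a} b → a < b → at π b < at π a → Σ ℕ λ k → a ≤ k × k < b × at π (suc k) < at π k
descent π {a} (suc b) (s≤s a≤b) πb+1<πa with at π (suc b) <? at π b
... | yes πb+1<πb = b , a≤b , ≤-refl , πb+1<πb
... | no  πb+1≮πb with m≤n⇒m<n∨m≡n a≤b
...   | inj₂ refl = contradiction πb+1<πa πb+1≮πb
...   | inj₁ a<b with descent π b a<b (≤-<-trans (≮⇒≥ πb+1≮πb) πb+1<πa)
...     | k , a≤k , k<b , πk+1<πk = k , a≤k , m<n⇒m<1+n k<b , πk+1<πk

∈-oneTo⁺ : ∀ {n y} → InRange n y → y ∈ oneTo n
∈-oneTo⁺ {y = suc y} (_ , y<n) = ∈-map⁺ suc (∈-upTo⁺ y<n)

∈-oneTo⁻ : ∀ {n y} → y ∈ oneTo n → InRange n y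
∈-oneTo⁻ y∈ with ∈-map⁻ suc y∈
... | x , x∈ , refl = s≤s z≤n , ∈-upTo⁻ x∈

oneTo-unique : ∀ n → Unique (oneTo n)
oneTo-unique n = Unique.map⁺ suc-injective (Unique.upTo⁺ n)

length-oneTo : ∀ n → length (oneTo n) ≡ n
length-oneTo n = trans (length-map suc (upTo n)) (length-upTo n)

prefixArgmax : List ℕ → ℕ → ℕ
prefixArgmax π K = argmax (at π) K (oneTo K)

prefixArgmax-inRange : ∀ π {K} → 1 ≤ K → InRange K (prefixArgmax π K)
prefixArgmax-inRange π {K} 1≤K = argmax-all (at π) {P = InRange K} (1≤K , ≤-refl) (All.tabulate ∈-oneTo⁻)

prefixArgmax-maximal : ∀ π {K y} → InRange K y → at π y ≤ at π (prefixArgmax π K)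
prefixArgmax-maximal π {K} y-in = All.lookup (f[xs]≤f[argmax] K (oneTo K)) (∈-oneTo⁺ y-in)

moveToTop : ℕ → ℕ → ℕ → ℕ
moveToTop c t v with <-cmp v c
... | tri< _ _ _ = v
... | tri≈ _ _ _ = t
... | tri> _ _ _ = pred v

module _ {c t : ℕ} where

  moveToTop-self : moveToTop c t c ≡ t
  moveToTop-self with <-cmp c c
  ... | tri< c<c _ _ = contradiction c<c (<-irrefl refl)
  ... | tri≈ _ _ _   = refl
  ... | tri> _ _ c>c = contradiction c>c (<-irrefl refl)

  moveToTop-strictMono : ∀ {u w} → u ≢ c → w ≢ c → u < w → moveToTop c t u < moveToTop c t w
  moveToTop-strictMono {u} {w} u≢c w≢c u<w with <-cmp u c | <-cmp w c
  ... | tri≈ _ u≡c _ | _            = contradiction u≡c u≢c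
  ... | _            | tri≈ _ w≡c _ = contradiction w≡c w≢c
  ... | tri< _ _ _   | tri< _ _ _   = u<w
  ... | tri< u<c _ _ | tri> _ _ c<w = <-≤-trans u<c (<⇒≤pred c<w)
  ... | tri> _ _ c<u | tri< w<c _ _ = contradiction (<-trans c<u u<w) (<-asym w<c)
  ... | tri> _ _ c<u | tri> _ _ _   = pred-mono-< {{>-nonZero (≤-<-trans z≤n c<u)}} u<w

  moveToTop-reflects-< : ∀ {u w} → u ≢ c → w ≢ c → moveToTop c t u < moveToTop c t w → u < w
  moveToTop-reflects-< {u} {w} u≢c w≢c fu<fw with <-cmp u w
  ... | tri< u<w _ _  = u<w
  ... | tri≈ _ refl _ = contradiction fu<fw (<-irrefl refl)
  ... | tri> _ _ w<u  = contradiction fu<fw (<-asym (moveToTop-strictMono w≢c u≢c w<u))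

  moveToTop-injective : ∀ {u w} → u ≢ c → w ≢ c → moveToTop c t u ≡ moveToTop c t w → u ≡ w
  moveToTop-injective {u} {w} u≢c w≢c fu≡fw with <-cmp u w
  ... | tri< u<w _ _ = contradiction fu≡fw (<⇒≢ (moveToTop-strictMono u≢c w≢c u<w))
  ... | tri≈ _ u≡w _ = u≡w
  ... | tri> _ _ w<u = contradiction fu≡fw (>⇒≢ (moveToTop-strictMono w≢c u≢c w<u))

  moveToTop-below : ∀ {N v} → 1 ≤ c → c ≤ N → InRange N v → v ≢ c →
                    1 ≤ moveToTop c t v × moveToTop c t v < N
  moveToTop-below {N} {v} 1≤c c≤N (1≤v , v≤N) v≢c with <-cmp v c
  ... | tri< v<c _ _ = 1≤v , <-≤-trans v<c c≤N
  ... | tri≈ _ v≡c _ = contradiction v≡c v≢c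
  ... | tri> _ _ c<v =
    ≤-trans 1≤c (<⇒≤pred c<v) , ≤-trans (≤-reflexive (suc-pred v {{>-nonZero (≤-<-trans z≤n c<v)}})) v≤N

-- Permutations

words-suc : ∀ k n → words (suc k) n ≡ cartesianProductWith (λ w x → x ∷ w) (words k n) (oneTo n)
words-suc k n = concatMap-map (λ w x → x ∷ w) (words k n) (oneTo n)

∈-words⁺ : ∀ {n} w → All (InRange n) w → w ∈ words (length w) n
∈-words⁺     []      []            = here refl
∈-words⁺ {n} (x ∷ w) (x-in ∷ w-in) =
  subst (x ∷ w ∈_) (sym (words-suc (length w) n))
    (∈-cartesianProductWith⁺ (λ w x → x ∷ w) (∈-words⁺ w w-in) (∈-oneTo⁺ x-in))

∈-words⁻ : ∀ k {n w} → w ∈ words k n → length w ≡ k × All (InRange n) w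
∈-words⁻ zero        (here refl) = refl , []
∈-words⁻ (suc k) {n} w∈
  with ∈-cartesianProductWith⁻ (λ w x → x ∷ w) (words k n) (oneTo n) (subst (_ ∈_) (words-suc k n) w∈)
... | w′ , x , w′∈ , x∈ , refl with ∈-words⁻ k w′∈
...   | refl , w′-in = refl , ∈-oneTo⁻ x∈ ∷ w′-in

words-unique : ∀ k n → Unique (words k n)
words-unique zero    n = [] ∷ []
words-unique (suc k) n = subst Unique (sym (words-suc k n))
  (Unique.cartesianProductWith⁺ (λ w x → x ∷ w) (λ { refl → refl , refl }) (words-unique k n) (oneTo-unique n))

record IsPerm (n : ℕ) (π : List ℕ) : Set where
  field
    length≡ : length π ≡ n
    unique  : Unique π
    bounded : All (InRange n) π

  inRange : ∀ {k} → InRange n k → InRange (length π) k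
  inRange = subst (λ l → InRange l _) (sym length≡)

  at-inRange : ∀ {k} → InRange n k → InRange n (at π k)
  at-inRange k-in = All.lookup bounded (at-∈ π (inRange k-in))

  at-injective′ : ∀ {a b} → InRange n a → InRange n b → at π a ≡ at π b → a ≡ b
  at-injective′ a-in b-in = at-injective π unique (inRange a-in) (inRange b-in)

∈-perms⁺ : ∀ {n π} → IsPerm n π → π ∈ perms n
∈-perms⁺ {n} {π} π-perm = ∈-filter⁺ unique? π∈words unique
  where
  open IsPerm π-perm
  π∈words : π ∈ words n n
  π∈words = subst (λ k → π ∈ words k n) length≡ (∈-words⁺ π bounded)

∈-perms⁻ : ∀ {n π} → π ∈ perms n → IsPerm n π
∈-perms⁻ {n} π∈ with ∈-filter⁻ unique? {xs = words n n} π∈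
... | π∈words , π-unique with ∈-words⁻ n π∈words
...   | π-length , π-bounded = record { length≡ = π-length ; unique = π-unique ; bounded = π-bounded }

perms-unique : ∀ n → Unique (perms n)
perms-unique n = Unique.filter⁺ unique? (words-unique n n)

IsPerm-∷ʳ : ∀ {n ρ} → IsPerm n ρ → IsPerm (suc n) (ρ ∷ʳ suc n)
IsPerm-∷ʳ {n} {ρ} ρ-perm = record
  { length≡ = trans (length-∷ʳ ρ (suc n)) (cong suc length≡)
  ; unique  = Unique.++⁺ unique ([] ∷ []) λ { (n+1∈ρ , here refl) → 1+n≰n (proj₂ (All.lookup bounded n+1∈ρ)) }
  ; bounded = AllP.++⁺ (All.map (map₂ m≤n⇒m≤1+n) bounded) ((s≤s z≤n , ≤-refl) ∷ [])
  }
  where open IsPerm ρ-perm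

-- Pigeonhole: the n distinct values of ρ all lie in [1, v), so v > n.
IsPerm-∷ʳ⁻ : ∀ {n ρ v} → IsPerm (suc n) (ρ ∷ʳ v) → (∀ {z} → z ∈ ρ ∷ʳ v → z ≤ v) →
             v ≡ suc n × IsPerm n ρ
IsPerm-∷ʳ⁻ {n} {ρ} {v} π-perm v-max = v≡1+n , record
  { length≡ = ρ-length
  ; unique  = ρ-unique
  ; bounded = All.tabulate λ z∈ρ → proj₁ (inRange-ρ z∈ρ) , ≤-pred (subst (_ <_) v≡1+n (below-v z∈ρ))
  }
  where
  open IsPerm π-perm
  ρ-length : length ρ ≡ n
  ρ-length = suc-injective (trans (sym (length-∷ʳ ρ v)) length≡)
  ρ-unique : Unique ρ
  ρ-unique = proj₁ (unique-∷ʳ⁻ ρ unique)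
  below-v : ∀ {z} → z ∈ ρ → z < v
  below-v z∈ρ = ≤∧≢⇒< (v-max (∈-++⁺ˡ z∈ρ)) λ { refl → proj₂ (unique-∷ʳ⁻ ρ unique) z∈ρ }
  inRange-ρ : ∀ {z} → z ∈ ρ → InRange (suc n) z
  inRange-ρ z∈ρ = All.lookup bounded (∈-++⁺ˡ z∈ρ)
  v-in : InRange (suc n) v
  v-in = All.lookup bounded (∈-++⁺ʳ ρ (here refl))
  v∷ρ⊆oneTo : v ∷ ρ ⊆ oneTo v
  v∷ρ⊆oneTo (here refl)  = ∈-oneTo⁺ (proj₁ v-in , ≤-refl)
  v∷ρ⊆oneTo (there z∈ρ) = ∈-oneTo⁺ (proj₁ (inRange-ρ z∈ρ) , <⇒≤ (below-v z∈ρ))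
  v≡1+n : v ≡ suc n
  v≡1+n = ≤-antisym (proj₂ v-in) (subst₂ _≤_ (cong suc ρ-length) (length-oneTo v)
            (unique⊆⇒length≤ (All.tabulate (λ z∈ρ → >⇒≢ (below-v z∈ρ)) ∷ ρ-unique) v∷ρ⊆oneTo))

-- Inversion sets

∈-pairsUpTo⁺ : ∀ {n i j} → InRange n i → InRange n j → (i , j) ∈ pairsUpTo n
∈-pairsUpTo⁺ {n} i-in j-in = subst (_ ∈_) (sym (concatMap-map _,_ (oneTo n) (oneTo n)))
  (∈-cartesianProductWith⁺ _,_ (∈-oneTo⁺ i-in) (∈-oneTo⁺ j-in))

jS-upperBound : ∀ {S a b} → (a , b) ∈ S → b ≤ jS S
jS-upperBound {(_ , b) ∷ S}  (here refl)  = m≤m⊔n b (jS S)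
jS-upperBound {(_ , b′) ∷ S} (there ab∈S) = ≤-trans (jS-upperBound ab∈S) (m≤n⊔m b′ (jS S))

jS-least : ∀ S {n} → (∀ {a b} → (a , b) ∈ S → b ≤ n) → jS S ≤ n
jS-least []            _  = z≤n
jS-least ((a , b) ∷ S) ub = ⊔-lub (ub (here refl)) (jS-least S (ub ∘ there))

mS-∷ : ∀ q S → mS S ≤ mS (q ∷ S)
mS-∷ (a , b) S with does (b ≟ suc a)
... | true  = m≤n⊔m a (mS S)
... | false = ≤-refl

-- The test `does (suc i ≟ suc i)` in mS computes to `i ≡ᵇ i`.
mS-upperBound : ∀ {S i} → (i , suc i) ∈ S → i ≤ mS S
mS-upperBound {(i , _) ∷ S} (here refl) with i ≡ᵇ i | ≡⇒≡ᵇ i i refl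
... | true | _ = m≤m⊔n i (mS S)
mS-upperBound {q ∷ S}       (there p)   = ≤-trans (mS-upperBound p) (mS-∷ q S)

module _ (h : ℕ → ℕ) (ρ ys : List ℕ) {n a b : ℕ} (ρ-length : length ρ ≡ n) where

  private
    prefix-at : ∀ {k} → InRange n k → at (ρ ++ ys) k ≡ at ρ k
    prefix-at k-in = at-++ˡ ρ ys (subst (λ l → InRange l _) (sym ρ-length) k-in)

  InInv-++⁺ : ∀ {n′} → n ≤ n′ → InInv h n ρ (a , b) → InInv h n′ (ρ ++ ys) (a , b)
  InInv-++⁺ n≤n′ (ab∈Ph@(1≤a , a<b , _) , b≤n , ρb<ρa) =
    let a-in , b-in = inRange-pair 1≤a a<b b≤n
    in ab∈Ph , ≤-trans b≤n n≤n′ , subst₂ _<_ (sym (prefix-at b-in)) (sym (prefix-at a-in)) ρb<ρa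

  InInv-++⁻ : ∀ {n′} → b ≤ n → InInv h n′ (ρ ++ ys) (a , b) → InInv h n ρ (a , b)
  InInv-++⁻ b≤n (ab∈Ph@(1≤a , a<b , _) , _ , πb<πa) =
    let a-in , b-in = inRange-pair 1≤a a<b b≤n
    in ab∈Ph , b≤n , subst₂ _<_ (prefix-at b-in) (prefix-at a-in) πb<πa

module _ (h : ℕ → ℕ) where

  ∈-inv⁺ : ∀ n π {a b} → InInv h n π (a , b) → (a , b) ∈ inv h n π
  ∈-inv⁺ n π ab-inv@((1≤a , a<b , _) , b≤n , _) =
    let a-in , b-in = inRange-pair 1≤a a<b b≤n
    in ∈-filter⁺ (InInv? h n π) (∈-pairsUpTo⁺ a-in b-in) ab-inv

  ∈-inv⁻ : ∀ n π {p} → p ∈ inv h n π → InInv h n π p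
  ∈-inv⁻ n π p∈ = proj₂ (∈-filter⁻ (InInv? h n π) {xs = pairsUpTo n} p∈)

  record Realises (S : List Pair) (n : ℕ) (π : List ℕ) : Set where
    field
      S⊆inv : ∀ {a b} → (a , b) ∈ S → InInv h n π (a , b)
      inv⊆S : ∀ {a b} → InInv h n π (a , b) → (a , b) ∈ S

  module _ {S : List Pair} {n : ℕ} {π : List ℕ} where

    sameSet⇒realises : SameSet (inv h n π) S → Realises S n π
    sameSet⇒realises (inv⊆S , S⊆inv) = record
      { S⊆inv = λ ab∈S → ∈-inv⁻ n π (All.lookup S⊆inv ab∈S)
      ; inv⊆S = λ ab-inv → All.lookup inv⊆S (∈-inv⁺ n π ab-inv)
      }

    realises⇒sameSet : Realises S n π → SameSet (inv h n π) S
    realises⇒sameSet π-real =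
      All.tabulate (λ { {a , b} ab∈inv → inv⊆S (∈-inv⁻ n π ab∈inv) }) ,
      All.tabulate (λ { {a , b} ab∈S → ∈-inv⁺ n π (S⊆inv ab∈S) })
      where open Realises π-real

  realisers : List Pair → ℕ → List (List ℕ)
  realisers S n = filter (λ π → SameSet? (inv h n π) S) (perms n)

  realisers-unique : ∀ S n → Unique (realisers S n)
  realisers-unique S n = Unique.filter⁺ _ (perms-unique n)

  module _ {S : List Pair} {n : ℕ} where

    ∈-realisers⁺ : ∀ {π} → IsPerm n π → Realises S n π → π ∈ realisers S n
    ∈-realisers⁺ π-perm π-real = ∈-filter⁺ _ (∈-perms⁺ π-perm) (realises⇒sameSet π-real)

    ∈-realisers⁻ : ∀ {π} → π ∈ realisers S n → IsPerm n π × Realises S n π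
    ∈-realisers⁻ π∈ with ∈-filter⁻ (λ π → SameSet? (inv h n π) S) {xs = perms n} π∈
    ... | π∈perms , same = ∈-perms⁻ π∈perms , sameSet⇒realises same

module Appending (h : ℕ → ℕ) (S : List Pair) where

  realises⇒jS≤ : ∀ {n π} → Realises h S n π → jS S ≤ n
  realises⇒jS≤ π-real = jS-least S (λ ab∈S → proj₁ (proj₂ (Realises.S⊆inv π-real ab∈S)))

  Realises-∷ʳ : ∀ {n ρ} → IsPerm n ρ → Realises h S n ρ → Realises h S (suc n) (ρ ∷ʳ suc n)
  Realises-∷ʳ {n} {ρ} ρ-perm ρ-real = record
    { S⊆inv = λ ab∈S → InInv-++⁺ h ρ [ suc n ] length≡ (n≤1+n n) (S⊆inv ab∈S)
    ; inv⊆S = inv⊆S′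
    }
    where
    open IsPerm ρ-perm
    open Realises ρ-real
    inv⊆S′ : ∀ {a b} → InInv h (suc n) (ρ ∷ʳ suc n) (a , b) → (a , b) ∈ S
    inv⊆S′ {a} {b} ab-inv@((1≤a , a<b , _) , b≤1+n , πb<πa) with m≤n⇒m<n∨m≡n b≤1+n
    ... | inj₁ (s≤s b≤n) = inv⊆S (InInv-++⁻ h ρ [ suc n ] length≡ b≤n ab-inv)
    ... | inj₂ refl      = contradiction πb<πa (≤⇒≯ πa≤πb)
      where
      a-in : InRange n a
      a-in = 1≤a , ≤-pred a<b
      open ≤-Reasoning
      πa≤πb : at (ρ ∷ʳ suc n) a ≤ at (ρ ∷ʳ suc n) (suc n)
      πa≤πb = begin
        at (ρ ∷ʳ suc n) a        ≡⟨ at-++ˡ ρ [ suc n ] (inRange a-in) ⟩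
        at ρ a                   ≤⟨ m≤n⇒m≤1+n (proj₂ (at-inRange a-in)) ⟩
        suc n                    ≡⟨ at-∷ʳ ρ (suc n) length≡ ⟨
        at (ρ ∷ʳ suc n) (suc n)  ∎

  Realises-∷ʳ⁻ : ∀ {n ρ v} → jS S ≤ n → length ρ ≡ n → Realises h S (suc n) (ρ ∷ʳ v) → Realises h S n ρ
  Realises-∷ʳ⁻ {n} {ρ} {v} J≤n ρ-length π-real = record
    { S⊆inv = λ ab∈S → InInv-++⁻ h ρ [ v ] ρ-length (≤-trans (jS-upperBound ab∈S) J≤n) (S⊆inv ab∈S)
    ; inv⊆S = λ ab-inv → inv⊆S (InInv-++⁺ h ρ [ v ] ρ-length (n≤1+n n) ab-inv)
    }
    where open Realises π-real

  extend-realiser : ∀ {n π} → IsPerm n π → Realises h S n π →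
                    ∀ k → Σ (List ℕ) λ p → IsPerm (k + n) p × Realises h S (k + n) p
  extend-realiser {π = π} π-perm π-real zero    = π , π-perm , π-real
  extend-realiser {n}     π-perm π-real (suc k) with extend-realiser π-perm π-real k
  ... | p , p-perm , p-real = p ∷ʳ suc (k + n) , IsPerm-∷ʳ p-perm , Realises-∷ʳ p-perm p-real

  admissible⇒realiser : Admissible h S → Σ ℕ λ n → Σ (List ℕ) λ π → IsPerm n π × Realises h S n π
  admissible⇒realiser (n , π , π∈perms , same) = n , π , ∈-perms⁻ π∈perms , sameSet⇒realises h same

  large-realiser : Admissible h S → ∀ K → Σ ℕ λ N → Σ (List ℕ) λ p → K ≤ N × IsPerm N p × Realises h S N p
  large-realiser adm K with admissible⇒realiser adm
  ... | n , π , π-perm , π-real with extend-realiser π-perm π-real K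
  ...   | p , p-perm , p-real = K + n , p , m≤m+n K n , p-perm , p-real

  extended : ℕ → List (List ℕ)
  extended n = map (_∷ʳ suc n) (realisers h S n)

  extended-unique : ∀ n → Unique (extended n)
  extended-unique n = Unique.map⁺ (∷ʳ-injectiveˡ _ _) (realisers-unique h S n)

  length-extended : ∀ n → length (extended n) ≡ I h S n
  length-extended n = length-map (_∷ʳ suc n) (realisers h S n)

  extended⊆realisers : ∀ {n} → extended n ⊆ realisers h S (suc n)
  extended⊆realisers π∈ with ∈-map⁻ (_∷ʳ _) π∈
  ... | ρ , ρ∈ , refl with ∈-realisers⁻ h ρ∈
  ...   | ρ-perm , ρ-real = ∈-realisers⁺ h (IsPerm-∷ʳ ρ-perm) (Realises-∷ʳ ρ-perm ρ-real)

  I≤I[1+n] : ∀ n → I h S n ≤ I h S (suc n)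
  I≤I[1+n] n = subst (_≤ I h S (suc n)) (length-extended n) (unique⊆⇒length≤ (extended-unique n) extended⊆realisers)

-- Bad indices

module InversionSet (h : ℕ → ℕ) (h-mono : ∀ i j → 1 ≤ i → i ≤ j → h i ≤ h j)
                    (h-inflationary : ∀ i → 1 ≤ i → i < h i) (S : List Pair) where

  open Appending h S

  m H J : ℕ
  m = mS S
  H = h m
  J = jS S

  NoBadIndex : Set
  NoBadIndex = ¬ Σ ℕ (BadIndex h S)

  1≤m : ∀ {a b} → (a , b) ∈ S → Admissible h S → 1 ≤ m
  1≤m ab∈S adm with admissible⇒realiser adm
  ... | n , π , π-perm , π-real with Realises.S⊆inv π-real ab∈S
  ...   | (1≤a , a<b , _) , b≤n , πb<πa with descent π _ a<b πb<πa
  ...     | k , a≤k , k<b , πk+1<πk = ≤-trans 1≤a (≤-trans a≤k (mS-upperBound k,k+1∈S))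
    where
    1≤k : 1 ≤ k
    1≤k = ≤-trans 1≤a a≤k
    k,k+1∈S : (k , suc k) ∈ S
    k,k+1∈S = Realises.inv⊆S π-real ((1≤k , ≤-refl , h-inflationary k 1≤k) , ≤-trans k<b b≤n , πk+1<πk)

  prefixMax⇒badIndex : ∀ {N p K x} → IsPerm N p → Realises h S N p → K ≤ N → J < K ⊎ H ≤ K →
                       1 ≤ x → x < K → (∀ {y} → InRange K y → at p y ≤ at p x) → BadIndex h S x
  prefixMax⇒badIndex {N} {p} {K} {x} p-perm p-real K≤N J<K⊎H≤K 1≤x x<K maximal =
    1≤x , x≤m , x-top , x-free
    where
    open IsPerm p-perm
    open Realises p-real
    x,y∈S : ∀ {y} → x < y → y ≤ h x → y ≤ K → (x , y) ∈ S
    x,y∈S {y} x<y y≤hx y≤K = inv⊆S ((1≤x , x<y , y≤hx) , ≤-trans y≤K K≤N , py<px)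
      where
      py<px : at p y < at p x
      py<px with inRange-pair 1≤x x<y (≤-trans y≤K K≤N)
      ... | x-in , y-in = ≤∧≢⇒< (maximal (proj₁ y-in , y≤K)) (>⇒≢ x<y ∘ at-injective′ y-in x-in)
    x≤m : x ≤ m
    x≤m = mS-upperBound (x,y∈S ≤-refl (h-inflationary x 1≤x) x<K)
    h[x]≤K : J < K ⊎ H ≤ K → h x ≤ K
    h[x]≤K (inj₂ H≤K) = ≤-trans (h-mono x m 1≤x x≤m) H≤K
    h[x]≤K (inj₁ J<K) with h x ≤? K
    ... | yes hx≤K = hx≤K
    ... | no  hx≰K = contradiction (jS-upperBound (x,y∈S x<K (<⇒≤ (≰⇒> hx≰K)) ≤-refl)) (<⇒≱ J<K)
    x-top : ∀ j → x < j → j ≤ h x → (x , j) ∈ S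
    x-top j x<j j≤hx = x,y∈S x<j j≤hx (≤-trans j≤hx (h[x]≤K J<K⊎H≤K))
    x-free : ∀ k → 1 ≤ k → k < x → x ≤ h k → (k , x) ∉ S
    x-free k 1≤k k<x _ k,x∈S =
      <⇒≱ (proj₂ (proj₂ (S⊆inv k,x∈S))) (maximal (1≤k , ≤-trans (<⇒≤ k<x) (<⇒≤ x<K)))

  prefixArgmax≡ : NoBadIndex → ∀ {N p K} → IsPerm N p → Realises h S N p → 1 ≤ K → K ≤ N → J < K ⊎ H ≤ K →
                  prefixArgmax p K ≡ K
  prefixArgmax≡ noBad {p = p} {K} p-perm p-real 1≤K K≤N J<K⊎H≤K with prefixArgmax-inRange p 1≤K
  ... | 1≤x , x≤K with m≤n⇒m<n∨m≡n x≤K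
  ...   | inj₂ x≡K = x≡K
  ...   | inj₁ x<K =
    ⊥-elim (noBad (_ , prefixMax⇒badIndex p-perm p-real K≤N J<K⊎H≤K 1≤x x<K (prefixArgmax-maximal p)))

  realisers⊆extended : NoBadIndex → ∀ {n} → J ≤ n → realisers h S (suc n) ⊆ extended n
  realisers⊆extended noBad {n} J≤n {π} π∈ with ∈-realisers⁻ h π∈ | initLast π
  ... | π-perm , π-real | ρ ∷ʳ′ v with IsPerm-∷ʳ⁻ π-perm v-max
    where
    open IsPerm π-perm
    last-is-max : prefixArgmax π (suc n) ≡ suc n
    last-is-max = prefixArgmax≡ noBad π-perm π-real (s≤s z≤n) ≤-refl (inj₁ (s≤s J≤n))
    π-last : at π (suc n) ≡ v
    π-last = at-∷ʳ ρ v (suc-injective (trans (sym (length-∷ʳ ρ v)) length≡))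
    v-max : ∀ {z} → z ∈ π → z ≤ v
    v-max z∈π with ∈⇒at π z∈π
    ... | k , k-in , refl = subst (_ ≤_) (trans (cong (at π) last-is-max) π-last)
                              (prefixArgmax-maximal π (subst (λ l → InRange l k) length≡ k-in))
  ... | refl , ρ-perm =
    ∈-map⁺ (_∷ʳ suc n) (∈-realisers⁺ h ρ-perm (Realises-∷ʳ⁻ J≤n (IsPerm.length≡ ρ-perm) π-real))

  I[1+n]≤I : NoBadIndex → ∀ {n} → J ≤ n → I h S (suc n) ≤ I h S n
  I[1+n]≤I noBad {n} J≤n = subst (I h S (suc n) ≤_) (length-extended n)
    (unique⊆⇒length≤ (realisers-unique h S (suc n)) (realisers⊆extended noBad J≤n))

  noBadIndex⇒constant : NoBadIndex → ConstantI h S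
  noBadIndex⇒constant noBad = I h S J , λ n J≤n → subst (λ n → I h S n ≡ I h S J) (m∸n+n≡m J≤n) (stable (n ∸ J))
    where
    stable : ∀ k → I h S (k + J) ≡ I h S J
    stable zero    = refl
    stable (suc k) = trans (≤-antisym (I[1+n]≤I noBad (m≤n+m J k)) (I≤I[1+n] (k + J))) (stable k)

  module NewRealiser {N p} (p-perm : IsPerm N p) (p-real : Realises h S N p) (H<N : H < N)
                     {i} (i-bad : BadIndex h S i) where

    open IsPerm p-perm

    1≤i : 1 ≤ i
    1≤i = proj₁ i-bad

    i-top : ∀ j → i < j → j ≤ h i → (i , j) ∈ S
    i-top = proj₁ (proj₂ (proj₂ i-bad))

    i-free : ∀ k → 1 ≤ k → k < i → i ≤ h k → (k , i) ∉ S
    i-free = proj₂ (proj₂ (proj₂ i-bad))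

    h[i]<N : h i < N
    h[i]<N = ≤-<-trans (h-mono i m 1≤i (proj₁ (proj₂ i-bad))) H<N

    i-in : InRange N i
    i-in = 1≤i , <⇒≤ (<-trans (h-inflationary i 1≤i) h[i]<N)

    c : ℕ
    c = at p i

    f : ℕ → ℕ
    f = moveToTop c (suc N)

    σ : List ℕ
    σ = map f p ∷ʳ N

    f-c : f c ≡ suc N
    f-c = moveToTop-self {c} {suc N}

    f-below : ∀ {v} → InRange N v → v ≢ c → 1 ≤ f v × f v < N
    f-below = moveToTop-below (proj₁ (at-inRange i-in)) (proj₂ (at-inRange i-in))

    1+N≢f : ∀ {v} → InRange N v → v ≢ c → suc N ≢ f v
    1+N≢f v-in v≢c = >⇒≢ (m<n⇒m<1+n (proj₂ (f-below v-in v≢c)))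

    f-inRange : ∀ {v} → InRange N v → InRange (suc N) (f v)
    f-inRange {v} v-in = case v ≟ c of λ where
      (yes refl) → subst (InRange (suc N)) (sym f-c) (s≤s z≤n , ≤-refl)
      (no  v≢c)  → map₂ (<⇒≤ ∘ m<n⇒m<1+n) (f-below v-in v≢c)

    f-≢N : ∀ {v} → InRange N v → f v ≢ N
    f-≢N {v} v-in = case v ≟ c of λ where
      (yes refl) fc≡N → 1+n≢n (trans (sym f-c) fc≡N)
      (no  v≢c)       → <⇒≢ (proj₂ (f-below v-in v≢c))

    f-injective : ∀ {u w} → InRange N u → InRange N w → f u ≡ f w → u ≡ w
    f-injective {u} {w} u-in w-in fu≡fw = case (u ≟ c) ,′ (w ≟ c) of λ where
      (yes refl , yes refl) → refl
      (yes refl , no  w≢c)  → contradiction (trans (sym f-c) fu≡fw) (1+N≢f w-in w≢c)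
      (no  u≢c  , yes refl) → contradiction (trans (sym f-c) (sym fu≡fw)) (1+N≢f u-in u≢c)
      (no  u≢c  , no  w≢c)  → moveToTop-injective u≢c w≢c fu≡fw

    σ-perm : IsPerm (suc N) σ
    σ-perm = record
      { length≡ = trans (length-∷ʳ (map f p) N) (cong suc (trans (length-map f p) length≡))
      ; unique  = Unique.++⁺ (map-unique-on f-injective bounded unique) ([] ∷ []) λ where
          (N∈ , here refl) → let v , v∈p , N≡fv = ∈-map⁻ f N∈ in f-≢N (All.lookup bounded v∈p) (sym N≡fv)
      ; bounded = AllP.++⁺ (AllP.map⁺ (All.map f-inRange bounded)) ((≤-trans 1≤i (proj₂ i-in) , n≤1+n N) ∷ [])
      }

    other≢c : ∀ {k} → InRange N k → k ≢ i → at p k ≢ c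
    other≢c k-in k≢i pk≡c = k≢i (at-injective′ k-in i-in pk≡c)

    σ-at : ∀ {k} → InRange N k → at σ k ≡ f (at p k)
    σ-at k-in = trans (at-++ˡ (map f p) [ N ] (subst (λ l → InRange l _) (sym (length-map f p)) (inRange k-in)))
                      (at-map f p (inRange k-in))

    σ-at-i : at σ i ≡ suc N
    σ-at-i = trans (σ-at i-in) f-c

    σ-at-last : at σ (suc N) ≡ N
    σ-at-last = at-∷ʳ (map f p) N (trans (length-map f p) length≡)

    σ-at-other : ∀ {k} → InRange N k → k ≢ i → at σ k < N
    σ-at-other k-in k≢i = subst (_< N) (sym (σ-at k-in)) (proj₂ (f-below (at-inRange k-in) (other≢c k-in k≢i)))

    σ-at-other<σ-at-i : ∀ {k} → InRange N k → k ≢ i → at σ k < at σ i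
    σ-at-other<σ-at-i k-in k≢i = subst (at σ _ <_) (sym σ-at-i) (m<n⇒m<1+n (σ-at-other k-in k≢i))

    σ-descent⁺ : ∀ {a b} → InRange N a → InRange N b → a ≢ i → b ≢ i → at p b < at p a → at σ b < at σ a
    σ-descent⁺ a-in b-in a≢i b≢i pb<pa = subst₂ _<_ (sym (σ-at b-in)) (sym (σ-at a-in))
      (moveToTop-strictMono (other≢c b-in b≢i) (other≢c a-in a≢i) pb<pa)

    σ-descent⁻ : ∀ {a b} → InRange N a → InRange N b → a ≢ i → b ≢ i → at σ b < at σ a → at p b < at p a
    σ-descent⁻ a-in b-in a≢i b≢i σb<σa = moveToTop-reflects-< (other≢c b-in b≢i) (other≢c a-in a≢i)
      (subst₂ _<_ (σ-at b-in) (σ-at a-in) σb<σa)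

    σ-S⊆inv : ∀ {a b} → (a , b) ∈ S → InInv h (suc N) σ (a , b)
    σ-S⊆inv {a} {b} ab∈S with Realises.S⊆inv p-real ab∈S
    ... | ab∈Ph@(1≤a , a<b , b≤ha) , b≤N , pb<pa = ab∈Ph , m≤n⇒m≤1+n b≤N , σb<σa
      where
      σb<σa : at σ b < at σ a
      σb<σa with inRange-pair 1≤a a<b b≤N | a ≟ i | b ≟ i
      ... | _ , b-in    | yes refl | _        = σ-at-other<σ-at-i b-in (>⇒≢ a<b)
      ... | _           | no  _    | yes refl = contradiction ab∈S (i-free a 1≤a a<b b≤ha)
      ... | a-in , b-in | no  a≢i  | no  b≢i  = σ-descent⁺ a-in b-in a≢i b≢i pb<pa

    σ-inv⊆S : ∀ {a b} → InInv h (suc N) σ (a , b) → (a , b) ∈ S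
    σ-inv⊆S {a} {b} (ab∈Ph@(1≤a , a<b , b≤ha) , b≤N+1 , σb<σa) with m≤n⇒m<n∨m≡n b≤N+1
    ... | inj₂ refl = contradiction σb<σa (<⇒≯ σa<σb)
      where
      a≢i : a ≢ i
      a≢i refl = <⇒≱ h[i]<N (≤-pred (m≤n⇒m≤1+n b≤ha))
      σa<σb : at σ a < at σ b
      σa<σb = subst (at σ a <_) (sym σ-at-last) (σ-at-other (1≤a , ≤-pred a<b) a≢i)
    ... | inj₁ (s≤s b≤N) with inRange-pair 1≤a a<b b≤N | a ≟ i | b ≟ i
    ...   | _           | yes refl | _        = i-top b a<b b≤ha
    ...   | a-in , _    | no  a≢i  | yes refl = contradiction σb<σa (<⇒≯ (σ-at-other<σ-at-i a-in a≢i))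
    ...   | a-in , b-in | no  a≢i  | no  b≢i  =
      Realises.inv⊆S p-real (ab∈Ph , b≤N , σ-descent⁻ a-in b-in a≢i b≢i σb<σa)

    σ-realises : Realises h S (suc N) σ
    σ-realises = record { S⊆inv = σ-S⊆inv ; inv⊆S = σ-inv⊆S }

    σ∉extended : σ ∉ extended N
    σ∉extended σ∈ with ∈-map⁻ (_∷ʳ suc N) σ∈
    ... | ρ , _ , σ≡ρ∷ʳN+1 = 1+n≢n (sym (∷ʳ-injectiveʳ (map f p) ρ σ≡ρ∷ʳN+1))

    I<I[1+N] : I h S N < I h S (suc N)
    I<I[1+N] = subst (λ l → suc l ≤ I h S (suc N)) (length-extended N)
      (unique⊆⇒length≤ (All.tabulate (λ π∈ σ≡π → σ∉extended (subst (_∈ _) (sym σ≡π) π∈)) ∷ extended-unique N)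
                       σ∷extended⊆realisers)
      where
      σ∷extended⊆realisers : σ ∷ extended N ⊆ realisers h S (suc N)
      σ∷extended⊆realisers (here refl) = ∈-realisers⁺ h σ-perm σ-realises
      σ∷extended⊆realisers (there π∈)  = extended⊆realisers π∈

  constant⇒noBadIndex : Admissible h S → ConstantI h S → NoBadIndex
  constant⇒noBadIndex adm (c , constant) (i , i-bad) with large-realiser adm (suc H)
  ... | N , p , H<N , p-perm , p-real =
    <-irrefl (trans (constant N J≤N) (sym (constant (suc N) (m≤n⇒m≤1+n J≤N))))
             (NewRealiser.I<I[1+N] p-perm p-real H<N i-bad)
    where
    J≤N : J ≤ N
    J≤N = realises⇒jS≤ p-real

  noGenerator⇒noSuccessor : ∀ {x} → (∀ {z} → ¬ GenS h S x z) → ∀ y → ¬ LtS h S x y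
  noGenerator⇒noSuccessor noGen y [ x<z ]⁺  = noGen x<z
  noGenerator⇒noSuccessor noGen y (x<z ∷ _) = noGen x<z

  badIndex<H : ∀ {i} → BadIndex h S i → i < H
  badIndex<H {i} (1≤i , i≤m , _) = <-≤-trans (h-inflationary i 1≤i) (h-mono i m 1≤i i≤m)

  badIndex⇒maximal : All (InPh h) S → ∀ {i} → BadIndex h S i → MaximalS h S i
  badIndex⇒maximal S⊆Ph {i} i-bad@(1≤i , _ , i-top , i-free) =
    1≤i , <⇒≤ (badIndex<H i-bad) , noGenerator⇒noSuccessor noGen
    where
    noGen : ∀ {z} → ¬ GenS h S i z
    noGen {z} (inj₁ z,i∈S) = let 1≤z , z<i , i≤hz = All.lookup S⊆Ph z,i∈S in i-free z 1≤z z<i i≤hz z,i∈S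
    noGen {z} (inj₂ ((_ , i<z , z≤hi) , i,z∉S , _)) = i,z∉S (i-top z i<z z≤hi)

  maximal⇒badIndex : ∀ {x} → MaximalS h S x → x ≢ H → BadIndex h S x
  maximal⇒badIndex {x} (1≤x , x≤H , maximal) x≢H = 1≤x , x≤m , x-top , x-free
    where
    x,j∈S : ∀ {j} → x < j → j ≤ h x → j ≤ H → (x , j) ∈ S
    x,j∈S {j} x<j j≤hx j≤H with (x , j) ∈? S
    ... | yes x,j∈S = x,j∈S
    ... | no  x,j∉S = contradiction [ inj₂ ((1≤x , x<j , j≤hx) , x,j∉S , j≤H) ]⁺ (maximal j)
    x≤m : x ≤ m
    x≤m = mS-upperBound (x,j∈S ≤-refl (h-inflationary x 1≤x) (≤∧≢⇒< x≤H x≢H))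
    x-top : ∀ j → x < j → j ≤ h x → (x , j) ∈ S
    x-top j x<j j≤hx = x,j∈S x<j j≤hx (≤-trans j≤hx (h-mono x m 1≤x x≤m))
    x-free : ∀ k → 1 ≤ k → k < x → x ≤ h k → (k , x) ∉ S
    x-free k _ _ _ k,x∈S = maximal k [ inj₁ k,x∈S ]⁺

  uniqueMax⇒noBadIndex : All (InPh h) S → UniqueMaxS h S → NoBadIndex
  uniqueMax⇒noBadIndex S⊆Ph (_ , unique) (i , i-bad) =
    <⇒≢ (badIndex<H i-bad) (unique i (badIndex⇒maximal S⊆Ph i-bad))

  noBadIndex⇒uniqueMax : S ≢ [] → Admissible h S → NoBadIndex → UniqueMaxS h S
  noBadIndex⇒uniqueMax S≢[] adm noBad = (1≤H , ≤-refl , noGenerator⇒noSuccessor noGen) , unique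
    where
    1≤H : 1 ≤ H
    1≤H = let 1≤m′ = 1≤m (proj₂ (≢[]⇒∈ S≢[])) adm in <⇒≤ (≤-<-trans 1≤m′ (h-inflationary m 1≤m′))
    noGen : ∀ {z} → ¬ GenS h S H z
    noGen (inj₂ ((_ , H<z , _) , _ , z≤H)) = <⇒≱ H<z z≤H
    noGen {z} (inj₁ z,H∈S) with large-realiser adm H
    ... | N , p , H≤N , p-perm , p-real with Realises.S⊆inv p-real z,H∈S
    ...   | (1≤z , z<H , _) , _ , pH<pz =
      <⇒≱ pH<pz (subst (λ x → at p z ≤ at p x) (prefixArgmax≡ noBad p-perm p-real 1≤H H≤N (inj₂ ≤-refl))
                  (prefixArgmax-maximal p (1≤z , <⇒≤ z<H)))
    unique : ∀ x → MaximalS h S x → x ≡ H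
    unique x x-max with x ≟ H
    ... | yes x≡H = x≡H
    ... | no  x≢H = ⊥-elim (noBad (x , maximal⇒badIndex x-max x≢H))

corollary4p8 : (h : ℕ → ℕ)
    → (∀ i j → 1 ≤ i → i ≤ j → h i ≤ h j)
    → (∀ i → 1 ≤ i → i < h i)
    → (S : List Pair)
    → S ≢ []
    → All (InPh h) S
    → Admissible h S
    → (ConstantI h S ⇔ (¬ Σ ℕ (BadIndex h S))) × (ConstantI h S ⇔ UniqueMaxS h S)
corollary4p8 h h-mono h-inflationary S S≢[] S⊆Ph adm =
  constant⇔noBadIndex ,
  ⇔-trans constant⇔noBadIndex (mk⇔ (noBadIndex⇒uniqueMax S≢[] adm) (uniqueMax⇒noBadIndex S⊆Ph))
  where
  open InversionSet h h-mono h-inflationary S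
  constant⇔noBadIndex : ConstantI h S ⇔ NoBadIndex
  constant⇔noBadIndex = mk⇔ (constant⇒noBadIndex adm) noBadIndex⇒constant
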